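{- For $m\ge 1$ let $L_m$ be the loopy star with $m$ leaves (so $m+1$ vertices). In the Strings-and-Coins game on $L_m$ under optimal play: if the number of vertices $m+1$ is even, Player 1 wins by exactly two points; if $m+1$ is odd, Player 2 wins by exactly three points.
   Context: Strings-and-Coins game: played on a finite multigraph (loops and parallel edges allowed) in which every vertex initially has at least one incident edge. Two players, Player 1 moving first, alternately remove one edge (a loop counts as one edge). Whenever a removal leaves one or more vertices with no incident edges, the mover earns one point for each such vertex and must move again, provided edges remain. The game ends when no edges remain; a player wins if they have more points. Optimal play means each player maximizes (own final score) minus (opponent's final score). "Player X wins by $k$ points" means that under optimal play the final score of X exceeds the opponent's by exactly $k$. The loopy star $L_m$ has a central vertex $c$ (with no loop) and $m$ outer vertices $v_1,\dots,v_m$; for each $i$ there is one edge $cv_i$ and one loop at $v_i$, and there are no other edges. -}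

module Defs where

open import Data.Nat using (ℕ; zero; suc; _+_; _*_)
open import Data.Bool using (Bool; true; false; if_then_else_; _∨_; not)
open import Data.Integer using (ℤ; +_; -_; _⊔_)
open import Data.Fin using (Fin; zero; suc; _≟_)
open import Data.Vec using (Vec; []; _∷_; removeAt; lookup; concat; tabulate)
open import Data.Product using (_×_; _,_)
open import Relation.Nullary.Decidable using (⌊_⌋)

Edge : ℕ → Set
Edge n = Fin n × Fin n

-- A finite multigraph on vertex set Fin n with k edges (parallel edges and
-- loops allowed) is a vector of k edges.
Multigraph : ℕ → ℕ → Set
Multigraph n k = Vec (Edge n) k

incident : ∀ {n} → Fin n → Edge n → Bool
incident v (a , b) = ⌊ v ≟ a ⌋ ∨ ⌊ v ≟ b ⌋

touched : ∀ {n k} → Fin n → Vec (Edge n) k → Bool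
touched v []       = false
touched v (e ∷ es) = incident v e ∨ touched v es

isoPt : ∀ {n k} → Fin n → Vec (Edge n) k → ℕ
isoPt v E = if touched v E then 0 else 1

-- Points earned by removing edge (a , b), leaving remaining edges E':
-- the number of (distinct) endpoints of the removed edge that are left with
-- no incident edge.  (Only endpoints of the removed edge can become newly
-- isolated.)
points : ∀ {n k} → Edge n → Vec (Edge n) k → ℕ
points (a , b) E' =
  if ⌊ a ≟ b ⌋ then isoPt a E' else isoPt a E' + isoPt b E'

maxFin : ∀ {k} → (Fin (suc k) → ℤ) → ℤ
maxFin {zero}  f = f zero
maxFin {suc k} f = f zero ⊔ maxFin (λ i → f (suc i))

-- value E = (score of the player to move) − (score of the opponent) from the
-- position with remaining edge set E, under optimal play (both players
-- maximize their own score minus the opponent's).  Removing edge i scores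
-- p = points; if p > 0 the same player moves again (if edges remain; when
-- no edge remains the value of the rest is 0), otherwise the turn passes.
value : ∀ {n k} → Vec (Edge n) k → ℤ
value {n} {zero}  []  = + 0
value {n} {suc k} E   = maxFin (λ i → move (lookup E i) (removeAt E i))
  where
  move : Edge n → Vec (Edge n) k → ℤ
  move e E' with points e E'
  ... | zero  = - value E'
  ... | suc p = + suc p Data.Integer.+ value E'

-- The loopy star L_m: vertex set Fin (suc m), centre c = zero (no loop),
-- outer vertices v_i = suc i for i : Fin m; edges c v_i and a loop at v_i.
loopyStar : (m : ℕ) → Multigraph (suc m) (2 * m)
loopyStar m = castLen (concat (tabulate {n = m} (λ i → (zero , suc i) ∷ (suc i , suc i) ∷ [])))
  where
  open import Data.Nat.Properties using (*-comm)
  open import Relation.Binary.PropositionalEquality using (subst)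
  castLen : Vec (Edge (suc m)) (m * 2) → Vec (Edge (suc m)) (2 * m)
  castLen = subst (Vec (Edge (suc m))) (*-comm m 2)

player1Margin : ∀ {n k} → Multigraph n k → ℤ
player1Margin G = value G

{-# OPTIONS --safe #-}
module Submission where

-- A position reachable from L_m is determined, as far as its value is concerned,
-- by the numbers a, b, d of leaves that still carry both edges, only their spoke,
-- or only their loop.  Its value for the player to move is b + d + c(a, b), where
-- c(0, 0) = 0, c(0, b+1) = 1 (the centre falls with the last spoke), and c(a, b)
-- = v(a) for a ≥ 1, with v(1) = 2 and v(a+1) = -(1 + v(a)): the mover collects
-- every free point, and once only full leaves remain each move hands the opponent
-- one leaf.  This is checked by induction on the number of edges: no move beats
-- the formula and an explicit move attains it.  L_m itself has a = m, b = d = 0,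
-- and v alternates between 2 and -3.

open import Defs
open import Data.Bool using (Bool; true; false; T; if_then_else_; _∨_)
import Data.Bool.Properties as Bool
open import Data.Empty using (⊥-elim)
open import Data.Fin using (Fin; zero; suc; _≟_)
open import Data.Fin.Properties using (suc-injective)
open import Data.Integer as ℤ using (ℤ; +_; -_; _+_; _≤_; _⊔_)
import Data.Integer.Properties as ℤ
open import Data.Integer.Tactic.RingSolver using (solve-∀)
open import Data.Nat as ℕ using (ℕ; zero; suc; _≥_)
import Data.Nat.Properties as ℕ
open import Data.Nat.Divisibility using (_∣_; _∣0; ∣1⇒≡1; ∣-refl; ∣m∣n⇒∣m+n; ∣m+n∣m⇒∣n)
open import Data.Product using (Σ-syntax; ∃-syntax; _×_; _,_; proj₁; proj₂)
open import Data.Product.Properties using (≡-dec)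
open import Data.Sum as Sum using (_⊎_; inj₁; inj₂)
open import Data.Unit using (tt)
open import Data.Vec using (Vec; []; _∷_; lookup; removeAt; concat; tabulate)
open import Data.Vec.Membership.Propositional using (_∈_; _∉_)
open import Data.Vec.Membership.Propositional.Properties using (∈-lookup)
open import Data.Vec.Relation.Unary.All as All using (All; []; _∷_)
import Data.Vec.Relation.Unary.All.Properties as All
open import Data.Vec.Relation.Unary.AllPairs using (_∷_; [])
import Data.Vec.Relation.Unary.AllPairs.Properties as AllPairs
open import Data.Vec.Relation.Unary.Any as Any using (here; there; any?)
import Data.Vec.Relation.Unary.Any.Properties as Any
open import Data.Vec.Relation.Unary.Unique.Propositional using (Unique)
open import Function using (_∘_; _⇔_; mk⇔; Equivalence)
open import Relation.Binary.Definitions using (DecidableEquality)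
open import Relation.Binary.PropositionalEquality
open import Relation.Nullary using (¬_; Dec; does; yes; no; contradiction; _⊎-dec_; T?)
open import Relation.Nullary.Decidable using (⌊_⌋; dec-true; dec-false; does-⇔; toWitness; fromWitness)

-- Optimal play as a maximum over moves

maxFin-cong : ∀ {k} {f g : Fin (suc k) → ℤ} → (∀ i → f i ≡ g i) → maxFin f ≡ maxFin g
maxFin-cong {zero}  f≗g = f≗g zero
maxFin-cong {suc k} f≗g = cong₂ _⊔_ (f≗g zero) (maxFin-cong (f≗g ∘ suc))

maxFin-upper : ∀ {k} (f : Fin (suc k) → ℤ) i → f i ≤ maxFin f
maxFin-upper {zero}  f zero    = ℤ.≤-refl
maxFin-upper {suc k} f zero    = ℤ.i≤i⊔j (f zero) _
maxFin-upper {suc k} f (suc i) = ℤ.≤-trans (maxFin-upper (f ∘ suc) i) (ℤ.i≤j⊔i (f zero) _)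

maxFin-least : ∀ {k} (f : Fin (suc k) → ℤ) {c} → (∀ i → f i ≤ c) → maxFin f ≤ c
maxFin-least {zero}  f f≤c = f≤c zero
maxFin-least {suc k} f f≤c = ℤ.⊔-lub (f≤c zero) (maxFin-least (f ∘ suc) (f≤c ∘ suc))

maxFin-attained : ∀ {k} (f : Fin (suc k) → ℤ) {c} → (∀ i → f i ≤ c) → ∃[ i ] f i ≡ c → maxFin f ≡ c
maxFin-attained f f≤c (i , fi≡c) =
  ℤ.≤-antisym (maxFin-least f f≤c) (subst (_≤ maxFin f) fi≡c (maxFin-upper f i))

moveValue : ℕ → ℤ → ℤ
moveValue zero    v = - v
moveValue (suc p) v = + suc p + v

value-unfold : ∀ {n k} (E : Vec (Edge n) (suc k)) →
  value E ≡ maxFin (λ i → moveValue (points (lookup E i) (removeAt E i)) (value (removeAt E i)))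
value-unfold E = maxFin-cong move≡
  where
  -- The per-move function of value is local to its where-block; unification names it.
  body : ∃[ f ] value E ≡ maxFin f
  body = _ , refl
  move≡ : ∀ i → proj₁ body i ≡ moveValue (points (lookup E i) (removeAt E i)) (value (removeAt E i))
  move≡ i with points (lookup E i) (removeAt E i)
  ... | zero  = refl
  ... | suc p = refl

-- Censuses of leaves and the value formula

-- Which of its two edges a leaf still has: (spoke , loop).
Leaf : Set
Leaf = Bool × Bool

_≟ˡ_ : DecidableEquality Leaf
_≟ˡ_ = ≡-dec Bool._≟_ Bool._≟_

-- Leaves with neither edge left are not counted.
record Census : Set where
  constructor census
  field
    full spokeOnly loopOnly : ℕ
open Census

add : Leaf → Census → Census
add (true  , true ) (census a b d) = census (suc a) b d
add (true  , false) (census a b d) = census a (suc b) d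
add (false , true ) (census a b d) = census a b (suc d)
add (false , false) c              = c

count : Leaf → Census → ℕ
count (true  , true ) = full
count (true  , false) = spokeOnly
count (false , true ) = loopOnly
count (false , false) = λ _ → 0

tally : ∀ {m} → (Fin m → Leaf) → Census
tally {zero}  σ = census 0 0 0
tally {suc m} σ = add (σ zero) (tally (σ ∘ suc))

add-comm : ∀ x y c → add x (add y c) ≡ add y (add x c)
add-comm (false , false) y               c = refl
add-comm x               (false , false) c = refl
add-comm (true  , true ) (true  , true ) c = refl
add-comm (true  , true ) (true  , false) c = refl
add-comm (true  , true ) (false , true ) c = refl
add-comm (true  , false) (true  , true ) c = refl
add-comm (true  , false) (true  , false) c = refl
add-comm (true  , false) (false , true ) c = refl
add-comm (false , true ) (true  , true ) c = refl
add-comm (false , true ) (true  , false) c = refl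
add-comm (false , true ) (false , true ) c = refl

count-add : ∀ {x y} c → y ≢ x → count x (add y c) ≡ count x c
count-add {y = false , false} c _   = refl
count-add {false , false}     c _   = refl
count-add {true  , true } {true  , true } c y≢x = contradiction refl y≢x
count-add {true  , true } {true  , false} c _   = refl
count-add {true  , true } {false , true } c _   = refl
count-add {true  , false} {true  , true } c _   = refl
count-add {true  , false} {true  , false} c y≢x = contradiction refl y≢x
count-add {true  , false} {false , true } c _   = refl
count-add {false , true } {true  , true } c _   = refl
count-add {false , true } {true  , false} c _   = refl
count-add {false , true } {false , true } c y≢x = contradiction refl y≢x

tally-cong : ∀ {m} {σ τ : Fin m → Leaf} → (∀ j → σ j ≡ τ j) → tally σ ≡ tally τ
tally-cong {zero}  _   = refl
tally-cong {suc m} σ≗τ = cong₂ add (σ≗τ zero) (tally-cong (σ≗τ ∘ suc))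

tally-update : ∀ {m} {σ τ : Fin m → Leaf} j → (∀ j′ → j′ ≢ j → σ j′ ≡ τ j′) →
               ∃[ R ] tally σ ≡ add (σ j) R × tally τ ≡ add (τ j) R
tally-update {σ = σ} zero agree =
  tally (σ ∘ suc) , refl , cong (add _) (sym (tally-cong (λ j → agree (suc j) λ ())))
tally-update {σ = σ} (suc j) agree
  with R , σ≡ , τ≡ ← tally-update j (λ j′ j′≢j → agree (suc j′) (j′≢j ∘ suc-injective)) =
  add (σ zero) R ,
  trans (cong (add (σ zero)) σ≡) (add-comm (σ zero) _ R) ,
  trans (cong₂ add (sym (agree zero λ ())) τ≡) (add-comm (σ zero) _ R)

tally-∃ : ∀ {m} (σ : Fin m → Leaf) x {n} → count x (tally σ) ≡ suc n → ∃[ j ] σ j ≡ x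
tally-∃ {zero}  σ (true  , true ) ()
tally-∃ {zero}  σ (true  , false) ()
tally-∃ {zero}  σ (false , true ) ()
tally-∃ {zero}  σ (false , false) ()
tally-∃ {suc m} σ x eq with σ zero ≟ˡ x
... | yes σ₀≡x = zero , σ₀≡x
... | no  σ₀≢x
  with j , σj≡x ← tally-∃ (σ ∘ suc) x (trans (sym (count-add (tally (σ ∘ suc)) σ₀≢x)) eq) =
  suc j , σj≡x

tally-bare : ∀ m → tally {m} (λ _ → false , false) ≡ census 0 0 0
tally-bare zero    = refl
tally-bare (suc m) = tally-bare m

tally-full : ∀ m → tally {m} (λ _ → true , true) ≡ census m 0 0
tally-full zero    = refl
tally-full (suc m) = cong (add (true , true)) (tally-full m)

noSpokes : ℕ → ℕ → ℕ
noSpokes zero zero = 1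
noSpokes _    _    = 0

centreIsolated : Census → ℕ
centreIsolated c = noSpokes (full c) (spokeOnly c)

centreIsolated-spoke : ∀ l R → centreIsolated (add (true , l) R) ≡ 0
centreIsolated-spoke true  R                    = refl
centreIsolated-spoke false (census zero    b d) = refl
centreIsolated-spoke false (census (suc a) b d) = refl

centreIsolated-loop : ∀ l R → centreIsolated (add (false , l) R) ≡ centreIsolated R
centreIsolated-loop true  R = refl
centreIsolated-loop false R = refl

centreIsolated-spokeless : ∀ {m} (σ : Fin m → Leaf) → (∀ j → proj₁ (σ j) ≡ false) →
                           centreIsolated (tally σ) ≡ 1
centreIsolated-spokeless {zero}  σ _ = refl
centreIsolated-spokeless {suc m} σ none with σ zero | none zero
... | false , l | refl =
  trans (centreIsolated-loop l _) (centreIsolated-spokeless (σ ∘ suc) (none ∘ suc))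

-- fullValue a = v(a + 1): the value of a + 1 full leaves and nothing else.
fullValue : ℕ → ℤ
fullValue zero    = + 2
fullValue (suc a) = - (+ 1 + fullValue a)

coreValue : ℕ → ℕ → ℤ
coreValue zero    zero    = + 0
coreValue zero    (suc _) = + 1
coreValue (suc a) _       = fullValue a

starValue : Census → ℤ
starValue c = + spokeOnly c + + loopOnly c + coreValue (full c) (spokeOnly c)

coreValue-spoke : ∀ a b → coreValue a (suc b) ≡ + noSpokes a b + coreValue a b
coreValue-spoke zero    zero    = refl
coreValue-spoke zero    (suc b) = refl
coreValue-spoke (suc a) b       = sym (ℤ.+-identityˡ (fullValue a))

data Cut : Leaf → Leaf → Set where
  cutSpoke : ∀ {l} → Cut (true , l) (false , l)
  cutLoop  : ∀ {s} → Cut (s , true) (s , false)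

isolated : Leaf → ℕ
isolated (s , l) = if s ∨ l then 0 else 1

-- The census argument is the census after the cut.
cutPoints : ∀ {x y} → Cut x y → Census → ℕ
cutPoints {y = y} cutSpoke c = isolated y ℕ.+ centreIsolated c
cutPoints {y = y} cutLoop  _ = isolated y

cutValue : ∀ {x y} → Cut x y → Census → ℤ
cutValue {y = y} t R = moveValue (cutPoints t (add y R)) (starValue (add y R))

-[n+i]≤n-i : ∀ n i → - (+ n + i) ≤ + n + - i
-[n+i]≤n-i n i =
  subst (_≤ + n + - i) (sym (ℤ.neg-distrib-+ (+ n) i)) (ℤ.+-monoˡ-≤ (- i) (ℤ.neg-≤-pos {n} {n}))

spokeOnly-cut : ∀ R → cutValue (cutSpoke {false}) R ≡ starValue (add (true , false) R)
spokeOnly-cut (census a b d) =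
  trans (shift (+ noSpokes a b) (+ b) (+ d) (coreValue a b))
        (cong (_+_ (+ suc b + + d)) (sym (coreValue-spoke a b)))
  where
  shift : ∀ n b d x → (+ 1 + n) + (b + d + x) ≡ (+ 1 + b) + d + (n + x)
  shift = solve-∀

loopOnly-cut : ∀ R → cutValue (cutLoop {false}) R ≡ starValue (add (false , true) R)
loopOnly-cut (census a b d) = shift (+ b) (+ d) (coreValue a b)
  where
  shift : ∀ b d x → + 1 + (b + d + x) ≡ b + (+ 1 + d) + x
  shift = solve-∀

cut-bound : ∀ {x y} (t : Cut x y) R → cutValue t R ≤ starValue (add x R)
cut-bound (cutSpoke {true}) (census zero zero d) =
  ℤ.≤-reflexive (shift (+ d))
  where
  shift : ∀ d → + 1 + (+ 0 + (+ 1 + d) + + 0) ≡ + 0 + d + + 2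
  shift = solve-∀
cut-bound (cutSpoke {true}) (census zero (suc b) d) = ℤ.-≤+
cut-bound (cutSpoke {true}) (census (suc a) b d) =
  ℤ.≤-trans (ℤ.≤-reflexive (cong -_ (shift (+ b) (+ d) (fullValue a))))
            (-[n+i]≤n-i (b ℕ.+ d) (+ 1 + fullValue a))
  where
  shift : ∀ b d x → b + (+ 1 + d) + x ≡ b + d + (+ 1 + x)
  shift = solve-∀
cut-bound (cutSpoke {false}) R = ℤ.≤-reflexive (spokeOnly-cut R)
cut-bound (cutLoop {true}) (census zero b d) = ℤ.-≤+
cut-bound (cutLoop {true}) (census (suc a) b d) =
  ℤ.≤-trans (ℤ.≤-reflexive (cong -_ (shift (+ b) (+ d) (fullValue a))))
            (-[n+i]≤n-i (b ℕ.+ d) (+ 1 + fullValue a))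
  where
  shift : ∀ b d x → (+ 1 + b) + d + x ≡ b + d + (+ 1 + x)
  shift = solve-∀
cut-bound (cutLoop {false}) R = ℤ.≤-reflexive (loopOnly-cut R)

Optimal : ∀ {x y} → Cut x y → Census → Set
Optimal {x} t c = ∀ R → add x R ≡ c → cutValue t R ≡ starValue c

spokeOnly-optimal : ∀ c → Optimal (cutSpoke {false}) c
spokeOnly-optimal _ R refl = spokeOnly-cut R

loopOnly-optimal : ∀ c → Optimal (cutLoop {false}) c
loopOnly-optimal _ R refl = loopOnly-cut R

lastFull-optimal : Optimal (cutSpoke {true}) (census 1 0 0)
lastFull-optimal (census 0 0 0) refl = refl

fullLoop-optimal : ∀ a → Optimal (cutLoop {true}) (census (suc (suc a)) 0 0)
fullLoop-optimal a (census _ 0 0) refl = sym (ℤ.+-identityˡ _)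

-- Membership, removal and incidence

module _ {A : Set} where

  All-removeAt : ∀ {P : A → Set} {k} {xs : Vec A (suc k)} → All P xs → ∀ i → All P (removeAt xs i)
  All-removeAt                    (_  ∷ pxs) zero    = pxs
  All-removeAt {xs = _ ∷ _ ∷ _} (px ∷ pxs) (suc i) = px ∷ All-removeAt pxs i

  Unique-removeAt : ∀ {k} {xs : Vec A (suc k)} → Unique xs → ∀ i → Unique (removeAt xs i)
  Unique-removeAt                    (_   ∷ u) zero    = u
  Unique-removeAt {xs = _ ∷ _ ∷ _} (x≢ ∷ u) (suc i) = All-removeAt x≢ i ∷ Unique-removeAt u i

  lookup∉removeAt : ∀ {k} {xs : Vec A (suc k)} → Unique xs → ∀ i → lookup xs i ∉ removeAt xs i
  lookup∉removeAt                    (x≢ ∷ _) zero    x∈       = All.lookup x≢ x∈ refl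
  lookup∉removeAt {xs = _ ∷ _ ∷ _} (x≢ ∷ _) (suc i) (here eq) = All.lookup⁺ x≢ i (sym eq)
  lookup∉removeAt {xs = _ ∷ _ ∷ _} (_  ∷ u) (suc i) (there y∈) = lookup∉removeAt u i y∈

  ∈-removeAt⁻ : ∀ {k x} {xs : Vec A (suc k)} i → x ∈ removeAt xs i → x ∈ xs
  ∈-removeAt⁻ {xs = _ ∷ _}       zero    x∈         = there x∈
  ∈-removeAt⁻ {xs = _ ∷ _ ∷ _} (suc i) (here eq)  = here eq
  ∈-removeAt⁻ {xs = _ ∷ _ ∷ _} (suc i) (there x∈) = there (∈-removeAt⁻ i x∈)

  ∈-removeAt⁺ : ∀ {k x} {xs : Vec A (suc k)} i → x ∈ xs → x ≢ lookup xs i → x ∈ removeAt xs i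
  ∈-removeAt⁺ {xs = _ ∷ _}       zero    (here eq)  x≢ = contradiction eq x≢
  ∈-removeAt⁺ {xs = _ ∷ _}       zero    (there x∈) _  = x∈
  ∈-removeAt⁺ {xs = _ ∷ _ ∷ _} (suc i) (here eq)  _  = here eq
  ∈-removeAt⁺ {xs = _ ∷ _ ∷ _} (suc i) (there x∈) x≢ = there (∈-removeAt⁺ i x∈ x≢)

incident⇒ : ∀ {n} (v a b : Fin n) → T (incident v (a , b)) → v ≡ a ⊎ v ≡ b
incident⇒ v a b v~e =
  Sum.map (toWitness {a? = v ≟ a}) (toWitness {a? = v ≟ b}) (Equivalence.to Bool.T-∨ v~e)

touched⁺ : ∀ {n k v e} {E : Vec (Edge n) k} → e ∈ E → T (incident v e) → T (touched v E)
touched⁺ (here refl) v~e = Equivalence.from Bool.T-∨ (inj₁ v~e)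
touched⁺ (there e∈E) v~e = Equivalence.from Bool.T-∨ (inj₂ (touched⁺ e∈E v~e))

touched⁻ : ∀ {n k v} (E : Vec (Edge n) k) → T (touched v E) → ∃[ e ] e ∈ E × T (incident v e)
touched⁻ (e ∷ E) v~E with Equivalence.to Bool.T-∨ v~E
... | inj₁ v~e = e , here refl , v~e
... | inj₂ v~E′ with e′ , e′∈E , v~e′ ← touched⁻ E v~E′ = e′ , there e′∈E , v~e′

-- Positions of the loopy star

spoke : ∀ {m} → Fin m → Edge (suc m)
spoke j = zero , suc j

loop : ∀ {m} → Fin m → Edge (suc m)
loop j = suc j , suc j

spoke≢loop : ∀ {m} {j j′ : Fin m} → spoke j ≢ loop j′
spoke≢loop ()

data StarEdge {m} : Edge (suc m) → Set where
  spokeᵉ : ∀ j → StarEdge (spoke j)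
  loopᵉ  : ∀ j → StarEdge (loop j)

record StarPosition {m k} (E : Vec (Edge (suc m)) k) : Set where
  field
    starEdges : All StarEdge E
    unique    : Unique E
open StarPosition

StarPosition-removeAt : ∀ {m k} {E : Vec (Edge (suc m)) (suc k)} → StarPosition E → ∀ i →
                        StarPosition (removeAt E i)
StarPosition-removeAt st i = record
  { starEdges = All-removeAt (starEdges st) i
  ; unique    = Unique-removeAt (unique st) i
  }

centre-incident : ∀ {m} {e : Edge (suc m)} → StarEdge e → T (incident zero e) → ∃[ j ] e ≡ spoke j
centre-incident (spokeᵉ j) _ = j , refl

leaf-incident : ∀ {m} {j : Fin m} {e} → StarEdge e → T (incident (suc j) e) → e ≡ spoke j ⊎ e ≡ loop j
leaf-incident {j = j} (spokeᵉ j′) j~e with incident⇒ (suc j) zero (suc j′) j~e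
... | inj₂ refl = inj₁ refl
leaf-incident {j = j} (loopᵉ j′)  j~e with incident⇒ (suc j) (suc j′) (suc j′) j~e
... | inj₁ refl = inj₂ refl
... | inj₂ refl = inj₂ refl

_≟ᵉ_ : ∀ {n} → DecidableEquality (Edge n)
_≟ᵉ_ = ≡-dec _≟_ _≟_

_∈?_ : ∀ {n k} (e : Edge n) (E : Vec (Edge n) k) → Dec (e ∈ E)
e ∈? E = any? (e ≟ᵉ_) E

witness : ∀ {A : Set} (a? : Dec A) → does a? ≡ true → A
witness (yes a) _ = a

leafOf : ∀ {m k} → Vec (Edge (suc m)) k → Fin m → Leaf
leafOf E j = does (spoke j ∈? E) , does (loop j ∈? E)

censusOf : ∀ {m k} → Vec (Edge (suc m)) k → Census
censusOf E = tally (leafOf E)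

module _ {m k} {E : Vec (Edge (suc m)) k} (st : StarPosition E) where

  isoPt-leaf : ∀ j → isoPt (suc j) E ≡ isolated (leafOf E j)
  isoPt-leaf j = cong (λ b → if b then 0 else 1)
    (does-⇔ (mk⇔ to from) (T? (touched (suc j) E)) (spoke j ∈? E ⊎-dec loop j ∈? E))
    where
    to : T (touched (suc j) E) → spoke j ∈ E ⊎ loop j ∈ E
    to j~E with e , e∈E , j~e ← touched⁻ E j~E =
      Sum.map (λ e≡ → subst (_∈ E) e≡ e∈E) (λ e≡ → subst (_∈ E) e≡ e∈E)
              (leaf-incident (All.lookup (starEdges st) e∈E) j~e)
    j~j : T ⌊ suc j ≟ suc j ⌋
    j~j = fromWitness refl
    from : spoke j ∈ E ⊎ loop j ∈ E → T (touched (suc j) E)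
    from (inj₁ s∈E) = touched⁺ s∈E j~j
    from (inj₂ l∈E) = touched⁺ l∈E (Equivalence.from (Bool.T-∨ {⌊ suc j ≟ suc j ⌋}) (inj₁ j~j))

  isoPt-centre : isoPt zero E ≡ centreIsolated (censusOf E)
  isoPt-centre with touched zero E in touched≡
  ... | true
    with e , e∈E , c~e ← touched⁻ E (subst T (sym touched≡) tt)
    with j , refl ← centre-incident (All.lookup (starEdges st) e∈E) c~e
    with R , census≡ , _ ← tally-update {σ = leafOf E} {leafOf E} j (λ _ _ → refl) =
      sym (begin
        centreIsolated (censusOf E)          ≡⟨ cong centreIsolated census≡ ⟩
        centreIsolated (add (leafOf E j) R)  ≡⟨ cong (λ s → centreIsolated (add (s , l) R))
                                                     (dec-true (spoke j ∈? E) e∈E) ⟩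
        centreIsolated (add (true , l) R)    ≡⟨ centreIsolated-spoke l R ⟩
        0                                    ∎)
    where
    open ≡-Reasoning
    l = does (loop j ∈? E)
  ... | false = sym (centreIsolated-spokeless (leafOf E) λ j →
    dec-false (spoke j ∈? E) (λ s∈E → subst T touched≡ (touched⁺ s∈E tt)))

cutEdge : ∀ {m x y} → Cut x y → Fin m → Edge (suc m)
cutEdge cutSpoke = spoke
cutEdge cutLoop  = loop

cutEdge-leaf : ∀ {m x y} (t : Cut x y) (j : Fin m) → proj₂ (cutEdge t j) ≡ suc j
cutEdge-leaf cutSpoke _ = refl
cutEdge-leaf cutLoop  _ = refl

record CutAt {m k} (E : Vec (Edge (suc m)) (suc k)) (i : Fin (suc k)) {x y} (t : Cut x y) : Set where
  field
    rest   : Census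
    before : censusOf E ≡ add x rest
    after  : censusOf (removeAt E i) ≡ add y rest
    scored : points (lookup E i) (removeAt E i) ≡ cutPoints t (censusOf (removeAt E i))

module _ {m k} {E : Vec (Edge (suc m)) (suc k)} (st : StarPosition E) (i : Fin (suc k)) where

  private
    E′  = removeAt E i
    st′ = StarPosition-removeAt st i

  membership-kept : ∀ {e} → e ≢ lookup E i → does (e ∈? E′) ≡ does (e ∈? E)
  membership-kept {e} e≢ =
    does-⇔ (mk⇔ (∈-removeAt⁻ {xs = E} i) (λ e∈E → ∈-removeAt⁺ i e∈E e≢)) (e ∈? E′) (e ∈? E)

  membership-removed : ∀ {e} → lookup E i ≡ e → does (e ∈? E′) ≡ false
  membership-removed {e} hit = dec-false (e ∈? E′) (subst (_∉ E′) hit (lookup∉removeAt (unique st) i))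

  leaves-kept : ∀ {x y} (t : Cut x y) {j} → lookup E i ≡ cutEdge t j →
                ∀ j′ → j′ ≢ j → leafOf E j′ ≡ leafOf E′ j′
  leaves-kept t {j} hit j′ j′≢j = sym (cong₂ _,_ (membership-kept (away refl)) (membership-kept (away refl)))
    where
    away : ∀ {e} → proj₂ e ≡ suc j′ → e ≢ lookup E i
    away {e} tip e≡ = j′≢j (suc-injective (begin
      suc j′                 ≡⟨ sym tip ⟩
      proj₂ e                ≡⟨ cong proj₂ (trans e≡ hit) ⟩
      proj₂ (cutEdge t j)    ≡⟨ cutEdge-leaf t j ⟩
      suc j                  ∎))
      where open ≡-Reasoning

  leaf-cut : ∀ {x y} (t : Cut x y) {j} → lookup E i ≡ cutEdge t j → leafOf E j ≡ x → leafOf E′ j ≡ y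
  leaf-cut cutSpoke hit leaf≡ = cong₂ _,_
    (membership-removed hit)
    (trans (membership-kept (λ e≡ → spoke≢loop (sym (trans e≡ hit)))) (cong proj₂ leaf≡))
  leaf-cut cutLoop hit leaf≡ = cong₂ _,_
    (trans (membership-kept (λ e≡ → spoke≢loop (trans e≡ hit))) (cong proj₁ leaf≡))
    (membership-removed hit)

  points-cut : ∀ {x y} (t : Cut x y) {j} → lookup E i ≡ cutEdge t j → leafOf E j ≡ x →
               points (lookup E i) E′ ≡ cutPoints t (censusOf E′)
  points-cut t@cutSpoke {j} hit leaf≡ = begin
    points (lookup E i) E′               ≡⟨ cong (λ e → points e E′) hit ⟩
    isoPt zero E′ ℕ.+ isoPt (suc j) E′   ≡⟨ ℕ.+-comm (isoPt zero E′) _ ⟩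
    isoPt (suc j) E′ ℕ.+ isoPt zero E′   ≡⟨ cong₂ ℕ._+_ (trans (isoPt-leaf st′ j) (cong isolated (leaf-cut t hit leaf≡)))
                                                        (isoPt-centre st′) ⟩
    cutPoints t (censusOf E′)            ∎
    where open ≡-Reasoning
  points-cut t@cutLoop {j} hit leaf≡ = begin
    points (lookup E i) E′  ≡⟨ cong (λ e → points e E′) hit ⟩
    points (loop j) E′      ≡⟨ cong (λ d → if ⌊ d ⌋ then isoPt (suc j) E′ else isoPt (suc j) E′ ℕ.+ isoPt (suc j) E′)
                                    (≡-≟-identity _≟_ {suc j} refl) ⟩
    isoPt (suc j) E′        ≡⟨ isoPt-leaf st′ j ⟩
    isolated (leafOf E′ j)  ≡⟨ cong isolated (leaf-cut t hit leaf≡) ⟩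
    cutPoints t (censusOf E′) ∎
    where open ≡-Reasoning

  cutAt : ∀ {x y} (t : Cut x y) {j} → lookup E i ≡ cutEdge t j → leafOf E j ≡ x → CutAt E i t
  cutAt t {j} hit leaf≡ with R , before , after ← tally-update j (leaves-kept t hit) = record
    { rest   = R
    ; before = subst (λ z → censusOf E ≡ add z R) leaf≡ before
    ; after  = subst (λ z → censusOf E′ ≡ add z R) (leaf-cut t hit leaf≡) after
    ; scored = points-cut t hit leaf≡
    }

starMoveValue : ∀ {m k} → Vec (Edge (suc m)) (suc k) → Fin (suc k) → ℤ
starMoveValue E i = moveValue (points (lookup E i) (removeAt E i)) (starValue (censusOf (removeAt E i)))

module _ {m k} {E : Vec (Edge (suc m)) (suc k)} where

  CutAt-value : ∀ {i x y} {t : Cut x y} (c : CutAt E i t) → starMoveValue E i ≡ cutValue t (CutAt.rest c)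
  CutAt-value {t = t} c =
    trans (cong (λ p → moveValue p (starValue (censusOf (removeAt E _)))) scored)
          (cong (λ c′ → moveValue (cutPoints t c′) (starValue c′)) after)
    where open CutAt c

  someCutAt : StarPosition E → ∀ i → Σ[ x ∈ Leaf ] Σ[ y ∈ Leaf ] Σ[ t ∈ Cut x y ] CutAt E i t
  someCutAt st i = at (All.lookup⁺ (starEdges st) i) refl
    where
    at : ∀ {e} → StarEdge e → lookup E i ≡ e → Σ[ x ∈ Leaf ] Σ[ y ∈ Leaf ] Σ[ t ∈ Cut x y ] CutAt E i t
    at (spokeᵉ j) hit = _ , _ , cutSpoke , cutAt st i cutSpoke hit
      (cong (_, does (loop j ∈? E)) (dec-true (spoke j ∈? E) (subst (_∈ E) hit (∈-lookup i E))))
    at (loopᵉ j) hit = _ , _ , cutLoop , cutAt st i cutLoop hit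
      (cong (does (spoke j ∈? E) ,_) (dec-true (loop j ∈? E) (subst (_∈ E) hit (∈-lookup i E))))

  cutEdge-present : ∀ {x y} (t : Cut x y) {j} → leafOf E j ≡ x → cutEdge t j ∈ E
  cutEdge-present cutSpoke {j} leaf≡ = witness (spoke j ∈? E) (cong proj₁ leaf≡)
  cutEdge-present cutLoop  {j} leaf≡ = witness (loop j ∈? E) (cong proj₂ leaf≡)

  move-bound : StarPosition E → ∀ i → starMoveValue E i ≤ starValue (censusOf E)
  move-bound st i with x , _ , t , c ← someCutAt st i = begin
    starMoveValue E i           ≡⟨ CutAt-value c ⟩
    cutValue t rest             ≤⟨ cut-bound t rest ⟩
    starValue (add x rest)      ≡⟨ cong starValue (sym before) ⟩
    starValue (censusOf E)      ∎
    where
    open CutAt c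
    open ℤ.≤-Reasoning

  optimal-move : StarPosition E → ∃[ i ] starMoveValue E i ≡ starValue (censusOf E)
  optimal-move st = choose (censusOf E) refl
    where
    play : ∀ {x y} (t : Cut x y) → ∃[ j ] leafOf E j ≡ x → Optimal t (censusOf E) →
           ∃[ i ] starMoveValue E i ≡ starValue (censusOf E)
    play t (j , leaf≡) optimal = i , trans (CutAt-value c) (optimal (CutAt.rest c) (sym (CutAt.before c)))
      where
      present = cutEdge-present t leaf≡
      i = Any.index present
      c = cutAt st i t (sym (Any.lookup-index present)) leaf≡
    -- Take a single-edge leaf if there is one; otherwise cut the spoke of the
    -- last full leaf, or a loop of one of several.
    choose : ∀ c → censusOf E ≡ c → ∃[ i ] starMoveValue E i ≡ starValue (censusOf E)
    choose (census a (suc b) d) eq =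
      play cutSpoke (tally-∃ (leafOf E) (true , false) (cong spokeOnly eq)) (spokeOnly-optimal _)
    choose (census a zero (suc d)) eq =
      play cutLoop (tally-∃ (leafOf E) (false , true) (cong loopOnly eq)) (loopOnly-optimal _)
    choose (census 1 zero zero) eq =
      play cutSpoke (tally-∃ (leafOf E) (true , true) (cong full eq))
           (subst (Optimal (cutSpoke {true})) (sym eq) lastFull-optimal)
    choose (census (suc (suc a)) zero zero) eq =
      play cutLoop (tally-∃ (leafOf E) (true , true) (cong full eq))
           (subst (Optimal (cutLoop {true})) (sym eq) (fullLoop-optimal a))
    choose (census zero zero zero) eq with _ , _ , t , c ← someCutAt st zero =
      ⊥-elim (nonempty t (trans (sym (CutAt.before c)) eq))
      where
      nonempty : ∀ {x y R} → Cut x y → add x R ≢ census 0 0 0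
      nonempty (cutSpoke {true})  ()
      nonempty (cutSpoke {false}) ()
      nonempty (cutLoop {true})   ()
      nonempty (cutLoop {false})  ()

value-star : ∀ {m k} {E : Vec (Edge (suc m)) k} → StarPosition E → value E ≡ starValue (censusOf E)
value-star {m} {E = []} _ = cong starValue (sym (tally-bare m))
value-star {E = E@(_ ∷ _)} st = begin
  value E                                                     ≡⟨ value-unfold E ⟩
  maxFin (λ i → moveValue (scored i) (value (removeAt E i)))  ≡⟨ maxFin-cong (λ i → cong (moveValue (scored i)) (ih i)) ⟩
  maxFin (starMoveValue E)                                    ≡⟨ maxFin-attained _ (move-bound st) (optimal-move st) ⟩
  starValue (censusOf E)                                      ∎
  where
  open ≡-Reasoning
  scored = λ i → points (lookup E i) (removeAt E i)
  ih = λ i → value-star (StarPosition-removeAt st i)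

-- The loopy star itself

fullLeaves : ∀ m → Vec (Edge (suc m)) (m ℕ.* 2)
fullLeaves m = concat (tabulate (λ j → spoke j ∷ loop j ∷ []))

FullStar : ∀ {m k} → Vec (Edge (suc m)) k → Set
FullStar E = StarPosition E × (∀ j → leafOf E j ≡ (true , true))

fullLeaves-fullStar : ∀ m → FullStar (fullLeaves m)
fullLeaves-fullStar m = star , full-leaf
  where
  star : StarPosition (fullLeaves m)
  star = record
    { starEdges = All.concat⁺ (All.tabulate⁺ (λ j → spokeᵉ j ∷ loopᵉ j ∷ []))
    ; unique    = AllPairs.concat⁺
        (All.tabulate⁺ (λ _ → (spoke≢loop ∷ []) ∷ [] ∷ []))
        (AllPairs.tabulate⁺ λ j≢j′ →
          (  (j≢j′ ∘ suc-injective ∘ cong proj₂) ∷ spoke≢loop ∷ [])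
          ∷ ((spoke≢loop ∘ sym) ∷ (j≢j′ ∘ suc-injective ∘ cong proj₂) ∷ [])
          ∷ [])
    }
  full-leaf : ∀ j → leafOf (fullLeaves m) j ≡ (true , true)
  full-leaf j = cong₂ _,_
    (dec-true (spoke j ∈? fullLeaves m) (Any.concat⁺ (Any.tabulate⁺ j (here refl))))
    (dec-true (loop j ∈? fullLeaves m) (Any.concat⁺ (Any.tabulate⁺ j (there (here refl)))))

subst-Vec : ∀ {A : Set} (P : ∀ {k} → Vec A k → Set) {k k′} (eq : k ≡ k′) {v : Vec A k} →
            P v → P (subst (Vec A) eq v)
subst-Vec P refl p = p

loopyStar-value : ∀ a → value (loopyStar (suc a)) ≡ fullValue a
loopyStar-value a = begin
  value (loopyStar (suc a))                  ≡⟨ value-star star ⟩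
  starValue (censusOf (loopyStar (suc a)))   ≡⟨ cong starValue (trans (tally-cong full-leaf) (tally-full (suc a))) ⟩
  + 0 + fullValue a                          ≡⟨ ℤ.+-identityˡ (fullValue a) ⟩
  fullValue a                                ∎
  where
  open ≡-Reasoning
  fullStar : FullStar (loopyStar (suc a))
  fullStar = subst-Vec FullStar (ℕ.*-comm (suc a) 2) (fullLeaves-fullStar (suc a))
  star = proj₁ fullStar
  full-leaf = proj₂ fullStar

fullValue-period : ∀ a → fullValue (suc (suc a)) ≡ fullValue a
fullValue-period a = cancel (fullValue a)
  where
  cancel : ∀ x → - (+ 1 + - (+ 1 + x)) ≡ x
  cancel = solve-∀

2∣2+ : ∀ {n} → 2 ∣ 2 ℕ.+ n ⇔ 2 ∣ n
2∣2+ = mk⇔ (λ 2∣2+n → ∣m+n∣m⇒∣n 2∣2+n ∣-refl) (∣m∣n⇒∣m+n ∣-refl)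

fullValue-parity : ∀ a → (2 ∣ a → fullValue a ≡ + 2) × (¬ 2 ∣ a → fullValue a ≡ - (+ 3))
fullValue-parity zero = (λ _ → refl) , (λ 2∤0 → contradiction (2 ∣0) 2∤0)
fullValue-parity (suc zero) = (λ 2∣1 → contradiction (∣1⇒≡1 2∣1) λ ()) , (λ _ → refl)
fullValue-parity (suc (suc a)) =
    (λ 2∣ → trans (fullValue-period a) (even (Equivalence.to 2∣2+ 2∣)))
  , (λ 2∤ → trans (fullValue-period a) (odd (2∤ ∘ Equivalence.from 2∣2+)))
  where
  even = proj₁ (fullValue-parity a)
  odd  = proj₂ (fullValue-parity a)

theorem3 : (m : ℕ) → m ≥ 1 →
    ((2 ∣ suc m) → player1Margin (loopyStar m) ≡ + 2)
    × ((¬ (2 ∣ suc m)) → player1Margin (loopyStar m) ≡ - (+ 3))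
theorem3 (suc a) _ =
    (λ 2∣ → trans (loopyStar-value a) (even (Equivalence.to 2∣2+ 2∣)))
  , (λ 2∤ → trans (loopyStar-value a) (odd (2∤ ∘ Equivalence.from 2∣2+)))
  where
  even = proj₁ (fullValue-parity a)
  odd  = proj₂ (fullValue-parity a)
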